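{- Let $x$ be the number of samples that remain after subsampling with parameter $s$. Suppose the subsampled structures consist of: an array storing the $x$ remaining samples using $\lceil\log n\rceil$ bits each; a bitvector of length $n$ with $x$ ones stored in compressed form using $\log(n/x)+O(1)$ bits per one; and a mapping array of $x$ entries using $\lceil\log x\rceil$ bits each. Then these structures use at most $\min(r,2\lceil n/(s+1)\rceil)\cdot(2\log n+O(1))$ bits of space.
   Context: $T[1..n]$ is a text with suffix array $SA$ and Burrows–Wheeler transform $BWT[i]=T[SA[i]-1]$ ($BWT[i]=T[n]$ if $SA[i]=1$); $r$ is the number of maximal runs of equal letters in $BWT$. For each run, its sample is the text position of its last letter, i.e. $SA[i]-1$ (taken as $n$ if $SA[i]=1$) where $i$ is the last position of the run. Let $l_1<l_2<\dots<l_r$ be these samples in increasing order. Subsampling with integer parameter $s\ge1$: for $i=2,3,\dots,r-1$ in this order, remove $l_i$ if $l_{i+1}-l'\le s$, where $l'$ is the largest not-removed sample among $l_1,\dots,l_{i-1}$. The samples not removed are the remaining samples ($l_1$ and $l_r$ always remain). -}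

module Defs where

open import Data.Nat using (ℕ; zero; suc; _+_; _*_; _∸_; _≤_; _⊓_; _≡ᵇ_; _<ᵇ_; _≤ᵇ_)
open import Data.Nat.DivMod using (_/_)
open import Data.Nat.Logarithm using (⌈log₂_⌉)
open import Data.Bool using (Bool; true; false; if_then_else_)
open import Data.Product using (_×_; _,_)
open import Data.List using (List; []; _∷_; length; drop; map; upTo)

-- Texts are nonempty lists over the alphabet ℕ; positions are 1-based: T[p] = at T p.

at : List ℕ → ℕ → ℕ
at T p with drop (p ∸ 1) T
... | []    = 0
... | a ∷ _ = a

lexLeq : List ℕ → List ℕ → Bool
lexLeq []       _        = true
lexLeq (_ ∷ _)  []       = false
lexLeq (a ∷ as) (b ∷ bs) =
  if a <ᵇ b then true else (if b <ᵇ a then false else lexLeq as bs)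

suffix : List ℕ → ℕ → List ℕ
suffix T p = drop (p ∸ 1) T

insertSuf : List ℕ → ℕ → List ℕ → List ℕ
insertSuf T p []       = p ∷ []
insertSuf T p (q ∷ qs) =
  if lexLeq (suffix T p) (suffix T q) then p ∷ q ∷ qs else q ∷ insertSuf T p qs

sortSuf : List ℕ → List ℕ → List ℕ
sortSuf T []       = []
sortSuf T (p ∷ ps) = insertSuf T p (sortSuf T ps)

SA : List ℕ → List ℕ
SA T = sortSuf T (map suc (upTo (length T)))

-- Text position "SA[i]-1" (n if SA[i] = 1) associated with a BWT entry.
prevPos : List ℕ → ℕ → ℕ
prevPos T 1 = length T
prevPos T p = p ∸ 1

BWTpairs : List ℕ → List (ℕ × ℕ)
BWTpairs T = map (λ p → (at T (prevPos T p) , prevPos T p)) (SA T)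

BWT : List ℕ → List ℕ
BWT T = map (λ p → at T (prevPos T p)) (SA T)

-- One sample per maximal run of equal letters: the text position of the run's last letter.
runSamples : List (ℕ × ℕ) → List ℕ
runSamples []                = []
runSamples ((c , p) ∷ [])    = p ∷ []
runSamples ((c , p) ∷ xs@((d , q) ∷ _)) =
  if c ≡ᵇ d then runSamples xs else p ∷ runSamples xs

r : List ℕ → ℕ
r T = length (runSamples (BWTpairs T))

insertℕ : ℕ → List ℕ → List ℕ
insertℕ a []       = a ∷ []
insertℕ a (b ∷ bs) = if a ≤ᵇ b then a ∷ b ∷ bs else b ∷ insertℕ a bs

sortℕ : List ℕ → List ℕ
sortℕ []       = []
sortℕ (a ∷ as) = insertℕ a (sortℕ as)

samples : List ℕ → List ℕ
samples T = sortℕ (runSamples (BWTpairs T))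

-- Subsampling: scanning l_i (i = 2..r-1) in order with l' the last kept sample,
-- remove l_i iff l_{i+1} - l' ≤ s.  First and last samples are always kept.
subsampleFrom : ℕ → ℕ → List ℕ → List ℕ
subsampleFrom s l' []                 = []
subsampleFrom s l' (x ∷ [])           = x ∷ []
subsampleFrom s l' (x ∷ ys@(y ∷ _)) =
  if (y ∸ l') ≤ᵇ s then subsampleFrom s l' ys else x ∷ subsampleFrom s x ys

subsample : ℕ → List ℕ → List ℕ
subsample s []       = []
subsample s (l ∷ ls) = l ∷ subsampleFrom s l ls

remaining : List ℕ → ℕ → List ℕ
remaining T s = subsample s (samples T)

xCount : List ℕ → ℕ → ℕ
xCount T s = length (remaining T s)

-- ⌈ m / k ⌉ (with ⌈ m / 0 ⌉ := 0, never used at k = 0 below).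
ceilDiv : ℕ → ℕ → ℕ
ceilDiv m zero    = 0
ceilDiv m (suc k) = (m + k) / suc k

-- Space in bits of the subsampled structures, where c is the O(1) per-one
-- overhead constant of the compressed bitvector:
--   x·⌈log n⌉  (samples)  +  x·(⌈log ⌈n/x⌉⌉ + c)  (bitvector)  +  x·⌈log x⌉  (mapping)
subsampledSpace : ℕ → List ℕ → ℕ → ℕ
subsampledSpace c T s =
  x * ⌈log₂ n ⌉ + x * (⌈log₂ (ceilDiv n x) ⌉ + c) + x * ⌈log₂ x ⌉
  where
    n = length T
    x = xCount T s

-- Each remaining sample is the sample of a distinct BWT run, so x ≤ r ≤ n. A sample l
-- is kept only when the sample after it lies more than s positions beyond the last kept
-- sample l′; hence kept samples advance by more than s every two steps, and x ≤ 2⌈n/(s+1)⌉.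
-- Each remaining sample costs ⌈log n⌉ + ⌈log ⌈n/x⌉⌉ + c + ⌈log x⌉ bits, and since
-- ⌈n/x⌉·x < 2n the last two logarithms add up to at most ⌈log n⌉ + 2.

module Submission where

open import Defs
open import Data.Nat
  using (ℕ; zero; suc; _+_; _*_; _∸_; _^_; _≤_; _<_; _≤ᵇ_; _≡ᵇ_; _⊓_; z≤n; s≤s; NonZero; >-nonZero; >-nonZero⁻¹)
open import Data.Nat.Properties
open import Data.Nat.DivMod using (_/_; m/n*n≤m; /-monoˡ-≤; m/n≡1+[m∸n]/n; m≥n⇒m/n>0)
open import Data.Nat.Logarithm using (⌈log₂_⌉; ⌈log₂⌉-mono-≤; ⌈log₂2*n⌉≡1+⌈log₂n⌉; ⌈log₂2^n⌉≡n)
open import Data.Nat.Solver using (module +-*-Solver)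
open import Algebra.Properties.CommutativeSemigroup *-commutativeSemigroup using (x∙yz≈y∙xz)
open import Data.Bool using (true; false; if_then_else_)
open import Data.Product using (∃; _×_; _,_; proj₁; proj₂)
open import Data.List using (List; []; _∷_; length; map; upTo)
open import Data.List.Properties using (length-map; length-upTo)
open import Data.List.Relation.Unary.All using (All; []; _∷_)
open import Data.List.Relation.Unary.All.Properties using (map⁺; applyUpTo⁺₁)
open import Data.List.Relation.Unary.Linked using (Linked; _∷_)
open import Data.List.Relation.Binary.Permutation.Propositional
  using (_↭_; ↭-refl; ↭-sym; prep; swap; module PermutationReasoning)
open import Data.List.Relation.Binary.Permutation.Propositional.Properties using (↭-length; All-resp-↭)
open import Data.List.Relation.Binary.Sublist.Propositional using (_⊆_; []; _∷_; _∷ʳ_)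
open import Data.List.Relation.Binary.Sublist.Propositional.Properties using (length-mono-≤; All-resp-⊆)
open import Data.List.Sort.InsertionSort.Base ≤-decTotalOrder using (insert; sort)
open import Data.List.Sort.InsertionSort.Properties ≤-decTotalOrder using (sort-↭; sort-↗)
open import Relation.Binary.PropositionalEquality
open import Relation.Nullary using (yes; no)
open import Relation.Nullary.Reflects using (ofⁿ)

⌈log₂⌉≤ : ∀ {m} k → m ≤ 2 ^ k → ⌈log₂ m ⌉ ≤ k
⌈log₂⌉≤ {m} k m≤2^k = subst (⌈log₂ m ⌉ ≤_) (⌈log₂2^n⌉≡n k) (⌈log₂⌉-mono-≤ m≤2^k)

⌈log₂[m*2^j]⌉≡⌈log₂m⌉+j : ∀ m j .{{_ : NonZero m}} → ⌈log₂ (m * 2 ^ j) ⌉ ≡ ⌈log₂ m ⌉ + j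
⌈log₂[m*2^j]⌉≡⌈log₂m⌉+j m zero = trans (cong ⌈log₂_⌉ (*-identityʳ m)) (sym (+-identityʳ _))
⌈log₂[m*2^j]⌉≡⌈log₂m⌉+j m (suc j) {{m≢0}} = begin
  ⌈log₂ (m * (2 * 2 ^ j)) ⌉ ≡⟨ cong ⌈log₂_⌉ (x∙yz≈y∙xz m 2 (2 ^ j)) ⟩
  ⌈log₂ (2 * (m * 2 ^ j)) ⌉ ≡⟨ ⌈log₂2*n⌉≡1+⌈log₂n⌉ (m * 2 ^ j) {{m*n≢0 m (2 ^ j) {{m≢0}} {{m^n≢0 2 j}}}} ⟩
  suc ⌈log₂ (m * 2 ^ j) ⌉   ≡⟨ cong suc (⌈log₂[m*2^j]⌉≡⌈log₂m⌉+j m j) ⟩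
  suc (⌈log₂ m ⌉ + j)       ≡⟨ +-suc ⌈log₂ m ⌉ j ⟨
  ⌈log₂ m ⌉ + suc j         ∎
  where open ≡-Reasoning

2^j≤m<2^[1+j] : ∀ m .{{_ : NonZero m}} → ∃ λ j → 2 ^ j ≤ m × m < 2 ^ suc j
2^j≤m<2^[1+j] 1 = 0 , ≤-refl , s≤s (s≤s z≤n)
2^j≤m<2^[1+j] (suc (suc m)) with 2^j≤m<2^[1+j] (suc m)
... | j , 2^j≤1+m , 1+m<2^[1+j] with suc (suc m) <? 2 ^ suc j
...   | yes 2+m<2^[1+j] = j , m≤n⇒m≤1+n 2^j≤1+m , 2+m<2^[1+j]
...   | no  2+m≮2^[1+j] = suc j , ≮⇒≥ 2+m≮2^[1+j] , (begin-strict
  suc (suc m)           ≤⟨ 1+m<2^[1+j] ⟩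
  2 ^ suc j             <⟨ m<m+n (2 ^ suc j) (m^n>0 2 (suc j)) ⟩
  2 ^ suc j + 2 ^ suc j ≡⟨ cong (2 ^ suc j +_) (+-identityʳ (2 ^ suc j)) ⟨
  2 ^ suc (suc j)       ∎)
  where open ≤-Reasoning

⌈log₂m⌉+⌈log₂n⌉≤1+⌈log₂[m*n]⌉ : ∀ m n .{{_ : NonZero m}} .{{_ : NonZero n}} →
                                ⌈log₂ m ⌉ + ⌈log₂ n ⌉ ≤ suc ⌈log₂ (m * n) ⌉
⌈log₂m⌉+⌈log₂n⌉≤1+⌈log₂[m*n]⌉ m n with 2^j≤m<2^[1+j] n
... | j , 2^j≤n , n<2^[1+j] = begin
  ⌈log₂ m ⌉ + ⌈log₂ n ⌉     ≤⟨ +-monoʳ-≤ ⌈log₂ m ⌉ (⌈log₂⌉≤ (suc j) (<⇒≤ n<2^[1+j])) ⟩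
  ⌈log₂ m ⌉ + suc j         ≡⟨ +-suc ⌈log₂ m ⌉ j ⟩
  suc (⌈log₂ m ⌉ + j)       ≡⟨ cong suc (⌈log₂[m*2^j]⌉≡⌈log₂m⌉+j m j) ⟨
  suc ⌈log₂ (m * 2 ^ j) ⌉   ≤⟨ s≤s (⌈log₂⌉-mono-≤ (*-monoʳ-≤ m 2^j≤n)) ⟩
  suc ⌈log₂ (m * n) ⌉       ∎
  where open ≤-Reasoning

[m+n]/n≡1+m/n : ∀ m n .{{_ : NonZero n}} → (m + n) / n ≡ suc (m / n)
[m+n]/n≡1+m/n m n = trans (m/n≡1+[m∸n]/n (m≤n+m n m)) (cong (λ k → suc (k / n)) (m+n∸n≡m m n))

ceilDiv-suc : ∀ m n → ceilDiv (suc m) (suc n) ≡ suc (m / suc n)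
ceilDiv-suc m n = trans (cong (_/ suc n) (sym (+-suc m n))) ([m+n]/n≡1+m/n m (suc n))

ceilDiv*n≤2m : ∀ {m n} → n ≤ m → ceilDiv m n * n ≤ 2 * m
ceilDiv*n≤2m {m} {zero}  _   = z≤n
ceilDiv*n≤2m {m} {suc k} n≤m = begin
  (m + k) / suc k * suc k ≤⟨ m/n*n≤m (m + k) (suc k) ⟩
  m + k                   ≤⟨ +-monoʳ-≤ m (≤-trans (n≤1+n k) n≤m) ⟩
  m + m                   ≡⟨ cong (m +_) (+-identityʳ m) ⟨
  2 * m                   ∎
  where open ≤-Reasoning

⌈log₂ceilDiv⌉+⌈log₂n⌉≤2+⌈log₂m⌉ : ∀ {m n} → n ≤ m → ⌈log₂ (ceilDiv m n) ⌉ + ⌈log₂ n ⌉ ≤ 2 + ⌈log₂ m ⌉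
⌈log₂ceilDiv⌉+⌈log₂n⌉≤2+⌈log₂m⌉ {m} {zero} _ = z≤n
⌈log₂ceilDiv⌉+⌈log₂n⌉≤2+⌈log₂m⌉ {suc m} {suc k} n≤m = begin
  ⌈log₂ q ⌉ + ⌈log₂ (suc k) ⌉     ≤⟨ ⌈log₂m⌉+⌈log₂n⌉≤1+⌈log₂[m*n]⌉ q (suc k) {{>-nonZero q>0}} ⟩
  suc ⌈log₂ (q * suc k) ⌉         ≤⟨ s≤s (⌈log₂⌉-mono-≤ (ceilDiv*n≤2m n≤m)) ⟩
  suc ⌈log₂ (2 * suc m) ⌉         ≡⟨ cong suc (⌈log₂2*n⌉≡1+⌈log₂n⌉ (suc m)) ⟩
  2 + ⌈log₂ (suc m) ⌉             ∎
  where
  open ≤-Reasoning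
  q = ceilDiv (suc m) (suc k)
  q>0 : 0 < q
  q>0 = m≥n⇒m/n>0 (s≤s (m≤n+m k m))

space≤ : ∀ c n x M → x ≤ n → x ≤ M →
         x * ⌈log₂ n ⌉ + x * (⌈log₂ (ceilDiv n x) ⌉ + c) + x * ⌈log₂ x ⌉ ≤ M * (2 * ⌈log₂ n ⌉ + (2 + c))
space≤ c n x M x≤n x≤M = begin
  x * L + x * (a + c) + x * b ≡⟨ cong (_+ x * b) (*-distribˡ-+ x L (a + c)) ⟨
  x * (L + (a + c)) + x * b   ≡⟨ *-distribˡ-+ x (L + (a + c)) b ⟨
  x * (L + (a + c) + b)       ≤⟨ *-mono-≤ x≤M per-sample ⟩
  M * (2 * L + (2 + c))       ∎
  where
  open ≤-Reasoning
  open +-*-Solver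
  L = ⌈log₂ n ⌉
  a = ⌈log₂ (ceilDiv n x) ⌉
  b = ⌈log₂ x ⌉
  per-sample : L + (a + c) + b ≤ 2 * L + (2 + c)
  per-sample = begin
    L + (a + c) + b   ≡⟨ solve 4 (λ L a b c → L :+ (a :+ c) :+ b := (a :+ b) :+ (L :+ c)) refl L a b c ⟩
    (a + b) + (L + c) ≤⟨ +-monoˡ-≤ (L + c) (⌈log₂ceilDiv⌉+⌈log₂n⌉≤2+⌈log₂m⌉ x≤n) ⟩
    (2 + L) + (L + c) ≡⟨ solve 2 (λ L c → (con 2 :+ L) :+ (L :+ c) := con 2 :* L :+ (con 2 :+ c)) refl L c ⟩
    2 * L + (2 + c)   ∎

runSamples-⊆ : ∀ xs → runSamples xs ⊆ map proj₂ xs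
runSamples-⊆ []                            = []
runSamples-⊆ ((c , p) ∷ [])                = refl ∷ []
runSamples-⊆ ((c , p) ∷ xs@((d , _) ∷ _)) with c ≡ᵇ d | runSamples-⊆ xs
... | true  | rest = p ∷ʳ rest
... | false | rest = refl ∷ rest

subsampleFrom-⊆ : ∀ s l′ ls → subsampleFrom s l′ ls ⊆ ls
subsampleFrom-⊆ s l′ []             = []
subsampleFrom-⊆ s l′ (l ∷ [])       = refl ∷ []
subsampleFrom-⊆ s l′ (l ∷ ls@(l₊ ∷ _))
  with (l₊ ∸ l′) ≤ᵇ s | subsampleFrom-⊆ s l′ ls | subsampleFrom-⊆ s l ls
... | true  | dropped | _    = l ∷ʳ dropped
... | false | _       | kept = refl ∷ kept

subsample-⊆ : ∀ s ls → subsample s ls ⊆ ls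
subsample-⊆ s []       = []
subsample-⊆ s (l ∷ ls) = refl ∷ subsampleFrom-⊆ s l ls

insertSuf-↭ : ∀ T p qs → insertSuf T p qs ↭ p ∷ qs
insertSuf-↭ T p []       = ↭-refl
insertSuf-↭ T p (q ∷ qs) with lexLeq (suffix T p) (suffix T q)
... | true  = ↭-refl
... | false = begin
  q ∷ insertSuf T p qs ↭⟨ prep q (insertSuf-↭ T p qs) ⟩
  q ∷ p ∷ qs           ↭⟨ swap q p ↭-refl ⟩
  p ∷ q ∷ qs           ∎
  where open PermutationReasoning

sortSuf-↭ : ∀ T ps → sortSuf T ps ↭ ps
sortSuf-↭ T []       = ↭-refl
sortSuf-↭ T (p ∷ ps) = begin
  insertSuf T p (sortSuf T ps) ↭⟨ insertSuf-↭ T p (sortSuf T ps) ⟩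
  p ∷ sortSuf T ps             ↭⟨ prep p (sortSuf-↭ T ps) ⟩
  p ∷ ps                       ∎
  where open PermutationReasoning

-- a ≤ᵇ b is definitionally does (a ≤? b), the test of the library's insertion sort.
insertℕ≡insert : ∀ a bs → insertℕ a bs ≡ insert a bs
insertℕ≡insert a []       = refl
insertℕ≡insert a (b ∷ bs) = cong (if a ≤ᵇ b then a ∷ b ∷ bs else_) (cong (b ∷_) (insertℕ≡insert a bs))

sortℕ≡sort : ∀ as → sortℕ as ≡ sort as
sortℕ≡sort []       = refl
sortℕ≡sort (a ∷ as) = trans (cong (insertℕ a) (sortℕ≡sort as)) (insertℕ≡insert a (sort as))

sortℕ-↭ : ∀ as → sortℕ as ↭ as
sortℕ-↭ as = subst (_↭ as) (sym (sortℕ≡sort as)) (sort-↭ as)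

sortℕ-↗ : ∀ as → Linked _≤_ (sortℕ as)
sortℕ-↗ as = subst (Linked _≤_) (sym (sortℕ≡sort as)) (sort-↗ as)

xCount≤r : ∀ T s → xCount T s ≤ r T
xCount≤r T s = ≤-trans (length-mono-≤ (subsample-⊆ s (samples T)))
                       (≤-reflexive (↭-length (sortℕ-↭ (runSamples (BWTpairs T)))))

r≤length : ∀ T → r T ≤ length T
r≤length T = begin
  r T                                  ≤⟨ length-mono-≤ (runSamples-⊆ (BWTpairs T)) ⟩
  length (map proj₂ (BWTpairs T))      ≡⟨ length-map proj₂ (BWTpairs T) ⟩
  length (BWTpairs T)                  ≡⟨ length-map _ (SA T) ⟩
  length (SA T)                        ≡⟨ ↭-length (sortSuf-↭ T (map suc (upTo (length T)))) ⟩
  length (map suc (upTo (length T)))   ≡⟨ length-map suc (upTo (length T)) ⟩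
  length (upTo (length T))             ≡⟨ length-upTo (length T) ⟩
  length T                             ∎
  where open ≤-Reasoning

[n∸b]+d≤n∸a : ∀ {n a b d} .{{_ : NonZero d}} → d ≤ b ∸ a → b ≤ n → (n ∸ b) + d ≤ n ∸ a
[n∸b]+d≤n∸a {n} {a} {b} {d} d≤b∸a b≤n = begin
  (n ∸ b) + d       ≤⟨ +-monoʳ-≤ (n ∸ b) d≤b∸a ⟩
  (n ∸ b) + (b ∸ a) ≡⟨ +-∸-assoc (n ∸ b) a≤b ⟨
  (n ∸ b) + b ∸ a   ≡⟨ cong (_∸ a) (m∸n+n≡m b≤n) ⟩
  n ∸ a             ∎
  where
  open ≤-Reasoning
  a≤b : a ≤ b
  a≤b = <⇒≤ (m∸n≢0⇒n<m (m<n⇒n≢0 (≤-trans (>-nonZero⁻¹ d) d≤b∸a)))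

1+[n∸b]/d≤[n∸a]/d : ∀ {n a b} d .{{_ : NonZero d}} → d ≤ b ∸ a → b ≤ n → suc ((n ∸ b) / d) ≤ (n ∸ a) / d
1+[n∸b]/d≤[n∸a]/d {n} {a} {b} d d≤b∸a b≤n = begin
  suc ((n ∸ b) / d) ≡⟨ [m+n]/n≡1+m/n (n ∸ b) d ⟨
  (n ∸ b + d) / d   ≤⟨ /-monoˡ-≤ d ([n∸b]+d≤n∸a {n} {a} d≤b∸a b≤n) ⟩
  (n ∸ a) / d       ∎
  where open ≤-Reasoning

-- Keeping l means l₊ − l′ > s, so the potential ⌊(n − l′)/(s+1)⌋ + ⌊(n − l)/(s+1)⌋
-- drops by at least one for every kept sample.
length-subsampleFrom≤ : ∀ s {n} l′ l ls → Linked _≤_ (l ∷ ls) → All (_≤ n) (l ∷ ls) →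
                        length (subsampleFrom s l′ (l ∷ ls)) ≤ suc ((n ∸ l′) / suc s + (n ∸ l) / suc s)
length-subsampleFrom≤ s l′ l [] _ _ = s≤s z≤n
length-subsampleFrom≤ s {n} l′ l (l₊ ∷ ls) (l≤l₊ ∷ sorted) (_ ∷ bounded@(l₊≤n ∷ _))
  with (l₊ ∸ l′) ≤ᵇ s | ≤ᵇ-reflects-≤ (l₊ ∸ l′) s
     | length-subsampleFrom≤ s l′ l₊ ls sorted bounded
     | length-subsampleFrom≤ s l l₊ ls sorted bounded
... | true  | _           | dropped | _    =
  ≤-trans dropped (s≤s (+-monoʳ-≤ (q l′) (/-monoˡ-≤ (suc s) (∸-monoʳ-≤ n l≤l₊))))
  where q = λ p → (n ∸ p) / suc s
... | false | ofⁿ l₊∸l′≰s | _       | kept = ≤-trans (s≤s kept) (begin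
  suc (suc (q l + q l₊)) ≡⟨ cong suc (+-suc (q l) (q l₊)) ⟨
  suc (q l + suc (q l₊)) ≤⟨ s≤s (+-monoʳ-≤ (q l) (1+[n∸b]/d≤[n∸a]/d {a = l′} (suc s) (≰⇒> l₊∸l′≰s) l₊≤n)) ⟩
  suc (q l + q l′)       ≡⟨ cong suc (+-comm (q l) (q l′)) ⟩
  suc (q l′ + q l)       ∎)
  where
  open ≤-Reasoning
  q = λ p → (n ∸ p) / suc s

length-subsample≤2*ceilDiv : ∀ s n .{{_ : NonZero n}} ls → Linked _≤_ ls → All (1 ≤_) ls → All (_≤ n) ls →
                    length (subsample s ls) ≤ 2 * ceilDiv n (suc s)
length-subsample≤2*ceilDiv s (suc n) [] _ _ _ = z≤n
length-subsample≤2*ceilDiv s (suc n) (l ∷ []) _ _ _ rewrite ceilDiv-suc n s = s≤s z≤n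
length-subsample≤2*ceilDiv s (suc n) (l ∷ l₊ ∷ ls) (_ ∷ sorted) (1≤l ∷ 1≤l₊ ∷ _) (_ ∷ bounded) = begin
  suc (length (subsampleFrom s l (l₊ ∷ ls))) ≤⟨ s≤s (length-subsampleFrom≤ s l l₊ ls sorted bounded) ⟩
  suc (suc (q l + q l₊))                     ≡⟨ cong suc (+-suc (q l) (q l₊)) ⟨
  suc (q l) + suc (q l₊)                     ≤⟨ +-mono-≤ (s≤s (q≤n/[s+1] 1≤l)) (s≤s (q≤n/[s+1] 1≤l₊)) ⟩
  suc (n / suc s) + suc (n / suc s)          ≡⟨ cong (suc (n / suc s) +_) (+-identityʳ _) ⟨
  2 * suc (n / suc s)                        ≡⟨ cong (2 *_) (ceilDiv-suc n s) ⟨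
  2 * ceilDiv (suc n) (suc s)                ∎
  where
  open ≤-Reasoning
  q = λ p → (suc n ∸ p) / suc s
  q≤n/[s+1] : ∀ {p} → 1 ≤ p → q p ≤ n / suc s
  q≤n/[s+1] 1≤p = /-monoˡ-≤ (suc s) (∸-monoʳ-≤ (suc n) 1≤p)

prevPos-inRange : ∀ T {i} → i < length T → 1 ≤ prevPos T (suc i) × prevPos T (suc i) ≤ length T
prevPos-inRange T {zero}  0<n   = 0<n , ≤-refl
prevPos-inRange T {suc i} 1+i<n = s≤s z≤n , <⇒≤ 1+i<n

samples-All : ∀ {P : ℕ → Set} T → (∀ {i} → i < length T → P (prevPos T (suc i))) → All P (samples T)
samples-All T P-prevPos =
  All-resp-↭ (↭-sym (sortℕ-↭ _))
    (All-resp-⊆ (runSamples-⊆ _)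
      (map⁺ (map⁺ (All-resp-↭ (↭-sym (sortSuf-↭ T _))
        (map⁺ (applyUpTo⁺₁ _ (length T) P-prevPos))))))

xCount≤2*ceilDiv : ∀ T s → 1 ≤ length T → xCount T s ≤ 2 * ceilDiv (length T) (suc s)
xCount≤2*ceilDiv T s 1≤n =
  length-subsample≤2*ceilDiv s (length T) {{>-nonZero 1≤n}} (samples T) (sortℕ-↗ (runSamples (BWTpairs T)))
    (samples-All T (λ i<n → proj₁ (prevPos-inRange T i<n)))
    (samples-All T (λ i<n → proj₂ (prevPos-inRange T i<n)))

-- The bound holds for s = 0 as well.
lemma5p1 : (c : ℕ) → ∃ λ (C : ℕ) → (T : List ℕ) → 1 ≤ length T → (s : ℕ) → 1 ≤ s →
    subsampledSpace c T s ≤ (r T ⊓ (2 * ceilDiv (length T) (s + 1))) * (2 * ⌈log₂ (length T) ⌉ + C)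
lemma5p1 c = 2 + c , λ T 1≤n s _ →
  space≤ c (length T) (xCount T s) _
    (≤-trans (xCount≤r T s) (r≤length T))
    (⊓-glb (xCount≤r T s)
           (subst (λ t → xCount T s ≤ 2 * ceilDiv (length T) t) (+-comm 1 s) (xCount≤2*ceilDiv T s 1≤n)))
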